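{- In an execution path of algorithm naive-fvs, started on $(G,k,\emptyset)$, that leads to a solution, $|F'|\le 3|V_-|$.
   Context: All graphs are finite, simple and undirected. Algorithm naive-fvs on an extended instance $(G,k,F)$, where $F\subseteq V(G)$ induces a forest; degrees are taken in the current graph $G$: 0. If $k<0$, return ``no''. If $V(G)=\emptyset$, return $\emptyset$. 1. If some vertex $v$ has degree less than two, return naive-fvs$(G-\{v\},k,F\setminus\{v\})$. 2. If some $v\in V(G)\setminus F$ has two neighbors in the same component of $G[F]$, recurse on $(G-\{v\},k-1,F)$ and add $v$ to the returned solution (return ``no'' if the recursion does). 3. Pick $v\in V(G)\setminus F$ of maximum degree. 4. If $d(v)=2$: repeatedly, while $G$ has a cycle, delete from $G$ some vertex of the cycle not in $F$ and put it into a set $X$. Return $X$ if $|X|\le k$, else ``no''. 5. Recurse on $(G-\{v\},k-1,F)$; if the result is not ``no'', return it together with $v$. 6. Return naive-fvs$(G,k,F\cup\{v\})$. Search tree. The execution is a search tree. Each node performs steps 0–4, absorbing the recursive calls of steps 1 and 2. If the node reaches step 5, it has two children, with entry instances $(G-\{v\},k-1,F)$ and $(G,k,F\cup\{v\})$. An execution path is a root-to-leaf path, and it leads to a solution if its leaf returns a solution (not ``no''). For such a path: - $V_-$ is the set of vertices deleted along it in steps 2, 4 or 5, i.e., the returned solution; - $F'$ is the set of vertices moved into $F$ by step 6 along the path. -}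

module Defs where

open import Data.Nat using (ℕ; _<_; _≤_)
open import Data.Integer as ℤ using (ℤ; +_; pred)
open import Data.Bool using (Bool; true; false)
open import Data.Fin using (Fin)
open import Data.Fin.Subset using (Subset; _∈_; _∉_; _∩_; _∪_; _-_; ∣_∣; ⁅_⁆; ⊥; ⊤; Empty)
open import Data.Vec using (tabulate)
open import Data.List using (List; _∷_; []; _++_; length)
open import Data.List.Relation.Unary.All using (All)
open import Data.List.Relation.Unary.Unique.Propositional using (Unique)
open import Data.List.Relation.Unary.Linked using (Linked)
open import Data.List.Membership.Propositional using () renaming (_∈_ to _∈ₗ_)
open import Data.Product using (Σ; ∃; ∃-syntax; _×_)
open import Relation.Binary.PropositionalEquality using (_≡_; _≢_)
open import Relation.Nullary using (¬_)

record SimpleGraph (n : ℕ) : Set where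
  field
    adj    : Fin n → Fin n → Bool
    sym    : ∀ u v → adj u v ≡ adj v u
    irrefl : ∀ v → adj v v ≡ false

-- Throughout, the "current graph" of an instance is the induced subgraph
-- G[A] of a fixed simple graph G on the alive vertex set A : Subset n.
module _ {n : ℕ} (G : SimpleGraph n) where
  open SimpleGraph G

  Adj : Fin n → Fin n → Set
  Adj u v = adj u v ≡ true

  nbr : Fin n → Subset n
  nbr v = tabulate (adj v)

  deg : Subset n → Fin n → ℕ
  deg A v = ∣ A ∩ nbr v ∣

  data Conn (S : Subset n) : Fin n → Fin n → Set where
    here : ∀ {u} → u ∈ S → Conn S u u
    step : ∀ {u w x} → u ∈ S → Adj u w → Conn S w x → Conn S u x

  record Cycle (A : Subset n) : Set where
    field
      start : Fin n
      rest  : List (Fin n)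
      long  : 2 ≤ length rest
      distinct : Unique (start ∷ rest)
      inside : All (_∈ A) (start ∷ rest)
      closed : Linked Adj (start ∷ (rest ++ (start ∷ [])))
    verts : List (Fin n)
    verts = start ∷ rest

  open Cycle public using (verts)

  TwoNbrsSameComp : Subset n → Subset n → Fin n → Set
  TwoNbrsSameComp A F v =
    ∃[ u ] ∃[ w ] (u ≢ w × u ∈ A × w ∈ A × u ∈ F × w ∈ F ×
                   Adj v u × Adj v w × Conn (A ∩ F) u w)

  -- the loop of step 4: Loop F A X  means that starting from the current
  -- vertex set A, repeatedly deleting a non-F vertex of some cycle until
  -- the graph is acyclic can delete exactly the set X.
  data Loop (F : Subset n) : Subset n → Subset n → Set where
    done : ∀ {A} → ¬ Cycle A → Loop F A ⊥
    del  : ∀ {A X x} (c : Cycle A) → x ∈ₗ verts c → x ∉ F →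
           Loop F (A - x) X → Loop F A (X ∪ ⁅ x ⁆)

  -- the node (k, A, F) reaches step 3 and picks v there: steps 0, 1, 2
  -- do not apply, and v is a vertex of V(G) ∖ F of maximum degree.
  record PicksAtStep3 (k : ℤ) (A F : Subset n) (v : Fin n) : Set where
    field
      k≥0     : + 0 ℤ.≤ k
      nonempty : ¬ Empty A
      no-step1 : ∀ u → u ∈ A → 2 ≤ deg A u
      no-step2 : ∀ u → u ∈ A → u ∉ F → ¬ TwoNbrsSameComp A F u
      v∈A     : v ∈ A
      v∉F     : v ∉ F
      maxdeg  : ∀ u → u ∈ A → u ∉ F → deg A u ≤ deg A v

  -- ExecPath k A F Vm Fp : there is an execution path of naive-fvs from
  -- the call on the instance (G[A], k, F) to a leaf returning a solution,
  -- along which Vm is the set of vertices deleted in steps 2, 4, 5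
  -- (= the returned solution V₋) and Fp is the set of vertices moved into
  -- F by step 6 (= F').  All choices ("some vertex", ties in step 3, the
  -- cycle vertices in step 4) are arbitrary.
  data ExecPath : ℤ → Subset n → Subset n → Subset n → Subset n → Set where
    leaf-empty : ∀ {k A F} → + 0 ℤ.≤ k → Empty A → ExecPath k A F ⊥ ⊥
    step1 : ∀ {k A F Vm Fp v} → + 0 ℤ.≤ k → v ∈ A → deg A v < 2 →
            ExecPath k (A - v) (F - v) Vm Fp → ExecPath k A F Vm Fp
    step2 : ∀ {k A F Vm Fp v} → + 0 ℤ.≤ k →
            (∀ u → u ∈ A → 2 ≤ deg A u) →
            v ∈ A → v ∉ F → TwoNbrsSameComp A F v →
            ExecPath (pred k) (A - v) F Vm Fp →
            ExecPath k A F (Vm ∪ ⁅ v ⁆) Fp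
    leaf-step4 : ∀ {k A F X v} → PicksAtStep3 k A F v → deg A v ≡ 2 →
            Loop F A X → + ∣ X ∣ ℤ.≤ k → ExecPath k A F X ⊥
    step5 : ∀ {k A F Vm Fp v} → PicksAtStep3 k A F v → ¬ (deg A v ≡ 2) →
            ExecPath (pred k) (A - v) F Vm Fp →
            ExecPath k A F (Vm ∪ ⁅ v ⁆) Fp
    step6 : ∀ {k A F Vm Fp v} → PicksAtStep3 k A F v → ¬ (deg A v ≡ 2) →
            ExecPath k A (F ∪ ⁅ v ⁆) Vm Fp →
            ExecPath k A F Vm (Fp ∪ ⁅ v ⁆)

-- For a node of the search tree with current vertex set A and forest set F let
-- Φ(A,F) = Σ_{u ∈ A} w(u), where w(u) = d(u) for u ∈ F and w(u) = min(2, d(u)) otherwise.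
-- If every vertex outside F has degree at most E + 2 with E ≥ 1, then along the rest of
-- the path E·|F′| + Φ ≤ 3E·|V₋| + 2|A|. Removing a vertex of degree at most 1 (step 1)
-- changes Φ by at most 2, as much as 2|A| changes. Deleting a vertex of degree
-- d ≤ E + 2 into V₋ changes Φ by at most d + 2 ≤ 3E + 2, which is what the right-hand side
-- changes by. Step 6 moves a vertex of maximum degree e + 2 ≥ 3 into F and raises Φ by
-- exactly e; below it the degree bound holds with e ≤ E, and as Φ ≥ 2|A| (all degrees are
-- at least 2 there) the inequality for e rescales to E. At a step-4 leaf the graph minus X
-- is a forest, so Φ ≤ Σ d ≤ 2|A| + 2|X|. At the root E = 2n + 1 exceeds the slack 2|A|.

module Submission where

open import Defs
open import Data.Integer using (ℤ)
open import Data.Bool using (if_then_else_)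
open import Data.Nat using (ℕ; zero; suc; _+_; _*_; _∸_; _⊓_; _≤_; _<_; z≤n; s≤s; s≤s⁻¹; z<s; _≤?_; >-nonZero)
open import Data.Nat.Properties
open import Data.Nat.Tactic.RingSolver using (solve-∀)
open import Algebra.Properties.CommutativeSemigroup +-commutativeSemigroup
  using (interchange; x∙yz≈y∙xz; x∙yz≈xz∙y; xy∙z≈xz∙y)
open import Data.Fin using (Fin; zero; suc)
open import Data.Fin.Subset
open import Data.Fin.Subset.Properties
open import Data.Vec using ([]; _∷_; here; there)
open import Data.Vec.Properties using ([]=⇒lookup; lookup⇒[]=; lookup∘tabulate)
open import Data.List using (List; []; _∷_; _++_; _∷ʳ_; length)
open import Data.List.Properties using (length-++; ∷ʳ-++)
open import Data.List.Relation.Unary.All as All using (All; []; _∷_)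
open import Data.List.Relation.Unary.All.Properties using (¬Any⇒All¬) renaming (++⁻ˡ to All-++⁻ˡ)
open import Data.List.Relation.Unary.Any using (here; there)
open import Data.List.Relation.Unary.AllPairs using (AllPairs; []; _∷_)
open import Data.List.Relation.Unary.Unique.Propositional using (Unique)
open import Data.List.Relation.Unary.Linked using (Linked; []; [-]; _∷_)
open import Data.List.Membership.Propositional using () renaming (_∈_ to _∈ₗ_)
open import Data.List.Membership.Propositional.Properties using (∈-∃++)
open import Data.Fin.Subset.Induction using (Acc; acc; ⊂-wellFounded; ⊃-wellFounded)
open import Data.Fin.Properties using (any?)
open import Data.Empty using (⊥-elim)
open import Data.Product using (∃-syntax; _×_; _,_)
open import Data.Sum using (inj₁; inj₂)
open import Function using (_∘_; _$_; _⇔_; mk⇔)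
open import Relation.Binary.PropositionalEquality
open import Relation.Nullary using (¬_; does; yes; no; contradiction)
open import Relation.Nullary.Decidable using (dec-true; dec-false; does-⇔; _×-dec_)

private
  variable
    n : ℕ
    A B : Subset n
    u v x : Fin n

scale-≤ : ∀ {e E p q g} → 0 < e → e ≤ E → e * p + g ≤ e * q → E * p + g ≤ E * q
scale-≤ {e} {E} {p} {q} {g} 0<e e≤E ep+g≤eq
  with t , refl ← m≤n⇒∃[o]m+o≡n (*-cancelˡ-≤ e {{>-nonZero 0<e}} (≤-trans (m≤m+n (e * p) g) ep+g≤eq))
  = begin
    E * p + g        ≤⟨ +-monoʳ-≤ (E * p) (≤-trans g≤et (*-monoˡ-≤ t e≤E)) ⟩
    E * p + E * t    ≡⟨ *-distribˡ-+ E p t ⟨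
    E * (p + t)      ∎
  where
  open ≤-Reasoning
  g≤et : g ≤ e * t
  g≤et = +-cancelˡ-≤ (e * p) g (e * t) (≤-trans ep+g≤eq (≤-reflexive (*-distribˡ-+ e p t)))

-- Sums over a subset

∑∈ : Subset n → (Fin n → ℕ) → ℕ
∑∈ []            w = 0
∑∈ (inside  ∷ p) w = w zero + ∑∈ p (w ∘ suc)
∑∈ (outside ∷ p) w = ∑∈ p (w ∘ suc)

𝟙 : Subset n → Fin n → ℕ
𝟙 p u = if does (u ∈? p) then 1 else 0

∑∈-cong : {w w′ : Fin n → ℕ} → (∀ {u} → u ∈ A → w u ≡ w′ u) → ∑∈ A w ≡ ∑∈ A w′
∑∈-cong {A = []}          eq = refl
∑∈-cong {A = inside  ∷ p} eq = cong₂ _+_ (eq here) (∑∈-cong (eq ∘ there))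
∑∈-cong {A = outside ∷ p} eq = ∑∈-cong (eq ∘ there)

∑∈-mono-≤ : {w w′ : Fin n → ℕ} → (∀ {u} → u ∈ A → w u ≤ w′ u) → ∑∈ A w ≤ ∑∈ A w′
∑∈-mono-≤ {A = []}          le = z≤n
∑∈-mono-≤ {A = inside  ∷ p} le = +-mono-≤ (le here) (∑∈-mono-≤ (le ∘ there))
∑∈-mono-≤ {A = outside ∷ p} le = ∑∈-mono-≤ (le ∘ there)

∑∈-distrib-+ : ∀ (A : Subset n) w w′ → ∑∈ A (λ u → w u + w′ u) ≡ ∑∈ A w + ∑∈ A w′
∑∈-distrib-+ []            w w′ = refl
∑∈-distrib-+ (inside  ∷ p) w w′ = trans (cong (w zero + w′ zero +_) (∑∈-distrib-+ p _ _))
  (interchange (w zero) (w′ zero) (∑∈ p (w ∘ suc)) (∑∈ p (w′ ∘ suc)))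
∑∈-distrib-+ (outside ∷ p) w w′ = ∑∈-distrib-+ p _ _

∑∈-const : ∀ (A : Subset n) c → ∑∈ A (λ _ → c) ≡ c * ∣ A ∣
∑∈-const []            c = sym (*-zeroʳ c)
∑∈-const (inside  ∷ p) c = trans (cong (c +_) (∑∈-const p c)) (sym (*-suc c ∣ p ∣))
∑∈-const (outside ∷ p) c = ∑∈-const p c

∣p∣≡∑∈p1 : ∀ (A : Subset n) → ∣ A ∣ ≡ ∑∈ A (λ _ → 1)
∣p∣≡∑∈p1 A = sym (trans (∑∈-const A 1) (*-identityˡ ∣ A ∣))

∑∈⊥≡0 : ∀ (w : Fin n → ℕ) → ∑∈ ⊥ w ≡ 0
∑∈⊥≡0 {zero}  w = refl
∑∈⊥≡0 {suc n} w = ∑∈⊥≡0 (w ∘ suc)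

∑∈-empty : ∀ w → Empty A → ∑∈ A w ≡ 0
∑∈-empty w empty rewrite Empty-unique empty = ∑∈⊥≡0 w

∑∈-remove : ∀ w → x ∈ A → ∑∈ A w ≡ w x + ∑∈ (A - x) w
∑∈-remove {A = inside ∷ p} w here = cong (λ q → w zero + ∑∈ q (w ∘ suc)) (sym (p─⊥≡p p))
∑∈-remove {A = inside ∷ p} w (there x∈p) =
  trans (cong (w zero +_) (∑∈-remove (w ∘ suc) x∈p)) (x∙yz≈y∙xz (w zero) (w (suc _)) _)
∑∈-remove {A = outside ∷ p} w (there x∈p) = ∑∈-remove (w ∘ suc) x∈p

∑∈-positive : ∀ {w : Fin n → ℕ} → 0 < ∑∈ A w → ∃[ u ] (u ∈ A × 0 < w u)
∑∈-positive {A = inside ∷ p} {w} pos with w zero in eq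
... | suc _ = zero , here , subst (0 <_) (sym eq) z<s
... | zero  with ∑∈-positive {A = p} pos
...   | u , u∈p , wu = suc u , there u∈p , wu
∑∈-positive {A = outside ∷ p} pos with ∑∈-positive {A = p} pos
... | u , u∈p , wu = suc u , there u∈p , wu

∣p∩q∣≡∑∈p𝟙q : ∀ (p q : Subset n) → ∣ p ∩ q ∣ ≡ ∑∈ p (𝟙 q)
∣p∩q∣≡∑∈p𝟙q []            []            = refl
∣p∩q∣≡∑∈p𝟙q (inside  ∷ p) (inside  ∷ q) = cong suc (∣p∩q∣≡∑∈p𝟙q p q)
∣p∩q∣≡∑∈p𝟙q (inside  ∷ p) (outside ∷ q) = ∣p∩q∣≡∑∈p𝟙q p q
∣p∩q∣≡∑∈p𝟙q (outside ∷ p) (_       ∷ q) = ∣p∩q∣≡∑∈p𝟙q p q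

𝟙≤1 : ∀ (p : Subset n) u → 𝟙 p u ≤ 1
𝟙≤1 p u with u ∈? p
... | yes _ = ≤-refl
... | no  _ = z≤n

𝟙-positive⇒∈ : ∀ (p : Subset n) u → 0 < 𝟙 p u → u ∈ p
𝟙-positive⇒∈ p u pos with u ∈? p
... | yes u∈p = u∈p

𝟙-∉ : ∀ {p : Subset n} → u ∉ p → 𝟙 p u ≡ 0
𝟙-∉ {u = u} {p} u∉p rewrite dec-false (u ∈? p) u∉p = refl

x∈p─q⇒x∉q : ∀ {p q : Subset n} → x ∈ p ─ q → x ∉ q
x∈p─q⇒x∉q {p = _ ∷ _} {outside ∷ _} here          ()
x∈p─q⇒x∉q {p = _ ∷ _} {_       ∷ _} (there x∈p─q) (there x∈q) = x∈p─q⇒x∉q x∈p─q x∈q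

x∈p-y⇒x≢y : x ∈ A - v → x ≢ v
x∈p-y⇒x≢y = x∉⁅y⁆⇒x≢y ∘ x∈p─q⇒x∉q

x∉p-x : x ∉ A - x
x∉p-x x∈A-x = x∈p-y⇒x≢y x∈A-x refl

p∪⁅x⁆-x⊆p : A ∪ ⁅ x ⁆ - x ⊆ A
p∪⁅x⁆-x⊆p {A = A} {x = x} u∈ with x∈p∪q⁻ A ⁅ x ⁆ (p─q⊆p _ _ u∈)
... | inj₁ u∈A  = u∈A
... | inj₂ u∈⁅x⁆ = contradiction (x∈⁅y⁆⇒x≡y x u∈⁅x⁆) (x∈p-y⇒x≢y u∈)

x∉p⇒p∪⁅x⁆-x≡p : x ∉ A → A ∪ ⁅ x ⁆ - x ≡ A
x∉p⇒p∪⁅x⁆-x≡p {A = A} x∉A = ⊆-antisym p∪⁅x⁆-x⊆p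
  λ u∈A → x∈p∧x≢y⇒x∈p-y (p⊆p∪q _ u∈A) λ { refl → x∉A u∈A }

∪⁅v⁆-⊆ : ∀ {X : Subset n} → v ∈ A → X ⊆ A - v → X ∪ ⁅ v ⁆ ⊆ A
∪⁅v⁆-⊆ {v = v} {A = A} {X} v∈A X⊆A-v u∈ with x∈p∪q⁻ X ⁅ v ⁆ u∈
... | inj₁ u∈X   = p─q⊆p A ⁅ v ⁆ (X⊆A-v u∈X)
... | inj₂ u∈⁅v⁆ rewrite x∈⁅y⁆⇒x≡y v u∈⁅v⁆ = v∈A

x∈p⇒∣p∣≡1+∣p-x∣ : x ∈ A → ∣ A ∣ ≡ suc ∣ A - x ∣
x∈p⇒∣p∣≡1+∣p-x∣ {x = x} {A = A} x∈A = begin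
  ∣ A ∣                        ≡⟨ ∣p∣≡∑∈p1 A ⟩
  ∑∈ A (λ _ → 1)               ≡⟨ ∑∈-remove _ x∈A ⟩
  suc (∑∈ (A - x) (λ _ → 1))   ≡⟨ cong suc (∣p∣≡∑∈p1 (A - x)) ⟨
  suc ∣ A - x ∣                ∎
  where open ≡-Reasoning

∣p∪⁅x⁆∣≤1+∣p∣ : ∀ (A : Subset n) x → ∣ A ∪ ⁅ x ⁆ ∣ ≤ suc ∣ A ∣
∣p∪⁅x⁆∣≤1+∣p∣ A x = begin
  ∣ A ∪ ⁅ x ⁆ ∣           ≡⟨ x∈p⇒∣p∣≡1+∣p-x∣ x∈A∪⁅x⁆ ⟩
  suc ∣ A ∪ ⁅ x ⁆ - x ∣   ≤⟨ s≤s (p⊆q⇒∣p∣≤∣q∣ (p∪⁅x⁆-x⊆p {A = A} {x = x})) ⟩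
  suc ∣ A ∣               ∎
  where
  open ≤-Reasoning
  x∈A∪⁅x⁆ : x ∈ A ∪ ⁅ x ⁆
  x∈A∪⁅x⁆ = x∈p∪q⁺ (inj₂ (x∈⁅x⁆ x))

x∉p⇒∣p∪⁅x⁆∣≡1+∣p∣ : x ∉ A → ∣ A ∪ ⁅ x ⁆ ∣ ≡ suc ∣ A ∣
x∉p⇒∣p∪⁅x⁆∣≡1+∣p∣ {x = x} {A = A} x∉A =
  trans (x∈p⇒∣p∣≡1+∣p-x∣ {A = A ∪ ⁅ x ⁆} (x∈p∪q⁺ (inj₂ (x∈⁅x⁆ x))))
        (cong (suc ∘ ∣_∣) (x∉p⇒p∪⁅x⁆-x≡p x∉A))

module _ {a r} {X : Set a} {R : X → X → Set r} where

  AllPairs-++⁻ˡ : ∀ xs {ys} → AllPairs R (xs ++ ys) → AllPairs R xs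
  AllPairs-++⁻ˡ []       _          = []
  AllPairs-++⁻ˡ (x ∷ xs) (px ∷ pxs) = All-++⁻ˡ xs px ∷ AllPairs-++⁻ˡ xs pxs

  Linked-++⁻ˡ : ∀ xs {ys} → Linked R (xs ++ ys) → Linked R xs
  Linked-++⁻ˡ []           _         = []
  Linked-++⁻ˡ (x ∷ [])     _         = [-]
  Linked-++⁻ˡ (x ∷ y ∷ xs) (r ∷ rxs) = r ∷ Linked-++⁻ˡ (y ∷ xs) rxs

  Linked-∷ʳ⁺ : ∀ xs {y z} → Linked R (xs ∷ʳ y) → R y z → Linked R (xs ∷ʳ y ∷ʳ z)
  Linked-∷ʳ⁺ []           _           ryz = ryz ∷ [-]
  Linked-∷ʳ⁺ (x ∷ [])     (rxy ∷ [-]) ryz = rxy ∷ ryz ∷ [-]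
  Linked-∷ʳ⁺ (x ∷ y ∷ xs) (rxy ∷ rxs) ryz = rxy ∷ Linked-∷ʳ⁺ (y ∷ xs) rxs ryz

fromList : List (Fin n) → Subset n
fromList []       = ⊥
fromList (x ∷ xs) = ⁅ x ⁆ ∪ fromList xs

∈fromList⇒∈ₗ : ∀ xs → u ∈ fromList xs → u ∈ₗ xs
∈fromList⇒∈ₗ []       u∈ = ⊥-elim (∉⊥ u∈)
∈fromList⇒∈ₗ (x ∷ xs) u∈ with x∈p∪q⁻ ⁅ x ⁆ (fromList xs) u∈
... | inj₁ u∈⁅x⁆ = here (x∈⁅y⁆⇒x≡y x u∈⁅x⁆)
... | inj₂ u∈xs  = there (∈fromList⇒∈ₗ xs u∈xs)

∈ₗ⇒∈fromList : ∀ {xs} → u ∈ₗ xs → u ∈ fromList xs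
∈ₗ⇒∈fromList (here refl) = x∈p∪q⁺ (inj₁ (x∈⁅x⁆ _))
∈ₗ⇒∈fromList (there u∈)  = x∈p∪q⁺ (inj₂ (∈ₗ⇒∈fromList u∈))

-- Degrees

module _ (G : SimpleGraph n) where
  open SimpleGraph G using (adj; irrefl) renaming (sym to adj-sym)

  ∈nbr⇒Adj : u ∈ nbr G v → Adj G v u
  ∈nbr⇒Adj {u = u} {v} u∈ = trans (sym (lookup∘tabulate (adj v) u)) ([]=⇒lookup u∈)

  Adj⇒∈nbr : Adj G v u → u ∈ nbr G v
  Adj⇒∈nbr {v = v} {u} vu = lookup⇒[]= u _ (trans (lookup∘tabulate (adj v) u) vu)

  Adj-sym : Adj G u v → Adj G v u
  Adj-sym {u = u} {v} uv = trans (adj-sym v u) uv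

  Adj-irrefl : ¬ Adj G v v
  Adj-irrefl {v = v} vv with () ← trans (sym (irrefl v)) vv

  𝟙nbr-sym : ∀ u v → 𝟙 (nbr G u) v ≡ 𝟙 (nbr G v) u
  𝟙nbr-sym u v = cong (λ b → if b then 1 else 0) (does-⇔ v∈⇔u∈ (v ∈? nbr G u) (u ∈? nbr G v))
    where
    v∈⇔u∈ : v ∈ nbr G u ⇔ u ∈ nbr G v
    v∈⇔u∈ = mk⇔ (Adj⇒∈nbr ∘ Adj-sym ∘ ∈nbr⇒Adj) (Adj⇒∈nbr ∘ Adj-sym ∘ ∈nbr⇒Adj)

  deg≡∑∈ : ∀ A v → deg G A v ≡ ∑∈ A (𝟙 (nbr G v))
  deg≡∑∈ A v = ∣p∩q∣≡∑∈p𝟙q A (nbr G v)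

  deg-mono : A ⊆ B → deg G A v ≤ deg G B v
  deg-mono {A = A} {v = v} A⊆B = p⊆q⇒∣p∣≤∣q∣ λ u∈ →
    let u∈A , u∈N = x∈p∩q⁻ A (nbr G v) u∈ in x∈p∩q⁺ (A⊆B u∈A , u∈N)

  deg-remove : x ∈ A → ∀ u → deg G A u ≡ 𝟙 (nbr G u) x + deg G (A - x) u
  deg-remove {x = x} {A = A} x∈A u = begin
    deg G A u                                ≡⟨ deg≡∑∈ A u ⟩
    ∑∈ A (𝟙 (nbr G u))                       ≡⟨ ∑∈-remove _ x∈A ⟩
    𝟙 (nbr G u) x + ∑∈ (A - x) (𝟙 (nbr G u)) ≡⟨ cong (_ +_) (deg≡∑∈ (A - x) u) ⟨
    𝟙 (nbr G u) x + deg G (A - x) u          ∎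
    where open ≡-Reasoning

  deg-remove-self : x ∈ A → deg G (A - x) x ≡ deg G A x
  deg-remove-self {x = x} {A = A} x∈A =
    sym (trans (deg-remove x∈A x) (cong (_+ deg G (A - x) x) (𝟙-∉ {u = x} (Adj-irrefl ∘ ∈nbr⇒Adj))))

  deg≤1+deg-remove : ∀ A x u → deg G A u ≤ suc (deg G (A - x) u)
  deg≤1+deg-remove A x u with x ∈? A
  ... | yes x∈A = ≤-trans (≤-reflexive (deg-remove x∈A u)) (+-monoˡ-≤ _ (𝟙≤1 (nbr G u) x))
  ... | no  x∉A = ≤-trans (deg-mono {A = A} {B = A - x} A⊆A-x) (n≤1+n _)
    where
    A⊆A-x : A ⊆ A - x
    A⊆A-x v∈A = x∈p∧x≢y⇒x∈p-y v∈A λ { refl → x∉A v∈A }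

  neighbour-avoiding : ∀ x → 2 ≤ deg G A u → ∃[ w ] (w ∈ A × Adj G u w × w ≢ x)
  neighbour-avoiding {A = A} {u = u} x 2≤deg =
    let w , w∈ , pos = ∑∈-positive {A = A - x} (subst (0 <_) (deg≡∑∈ (A - x) u) 0<deg)
    in  w , p─q⊆p A ⁅ x ⁆ w∈ , ∈nbr⇒Adj (𝟙-positive⇒∈ (nbr G u) w pos) , x∈p-y⇒x≢y w∈
    where
    0<deg : 0 < deg G (A - x) u
    0<deg = s≤s⁻¹ (≤-trans 2≤deg (deg≤1+deg-remove A x u))

  ∑∈-𝟙nbr : x ∈ A → ∑∈ (A - x) (λ u → 𝟙 (nbr G u) x) ≡ deg G A x
  ∑∈-𝟙nbr {x = x} {A = A} x∈A = begin
    ∑∈ (A - x) (λ u → 𝟙 (nbr G u) x)   ≡⟨ ∑∈-cong {A = A - x} (λ {u} _ → 𝟙nbr-sym u x) ⟩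
    ∑∈ (A - x) (𝟙 (nbr G x))           ≡⟨ deg≡∑∈ (A - x) x ⟨
    deg G (A - x) x                    ≡⟨ deg-remove-self x∈A ⟩
    deg G A x                          ∎
    where open ≡-Reasoning

  degSum : Subset n → ℕ
  degSum A = ∑∈ A (deg G A)

  degSum-remove : x ∈ A → degSum A ≡ deg G A x + (deg G A x + degSum (A - x))
  degSum-remove {x = x} {A = A} x∈A = begin
    degSum A
      ≡⟨ ∑∈-remove _ x∈A ⟩
    d + ∑∈ (A - x) (deg G A)
      ≡⟨ cong (d +_) (∑∈-cong {A = A - x} λ {u} _ → deg-remove x∈A u) ⟩
    d + ∑∈ (A - x) (λ u → 𝟙 (nbr G u) x + deg G (A - x) u)
      ≡⟨ cong (d +_) (∑∈-distrib-+ (A - x) _ _) ⟩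
    d + (∑∈ (A - x) (λ u → 𝟙 (nbr G u) x) + degSum (A - x))
      ≡⟨ cong (λ s → d + (s + degSum (A - x))) (∑∈-𝟙nbr x∈A) ⟩
    d + (d + degSum (A - x))
      ∎
    where
    open ≡-Reasoning
    d = deg G A x

  -- Cycles and forests

  Cycle-mono : A ⊆ B → Cycle G A → Cycle G B
  Cycle-mono A⊆B c = record
    { start = start ; rest = rest ; long = long ; distinct = distinct
    ; inside = All.map A⊆B (Cycle.inside c) ; closed = closed }
    where open Cycle c

  record Path (A : Subset n) : Set where
    constructor path
    field
      end next : Fin n
      rest     : List (Fin n)
      distinct : Unique (end ∷ next ∷ rest)
      within   : All (_∈ A) (end ∷ next ∷ rest)
      linked   : Linked (Adj G) (end ∷ next ∷ rest)

    vertices : List (Fin n)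
    vertices = end ∷ next ∷ rest

  open Path

  -- w lies beyond next on the path, so the prefix ending at w closes up through the edge end–w.
  close : ∀ {w} (P : Path A) → Adj G (end P) w → w ≢ next P → w ∈ₗ vertices P → Cycle G A
  close _ e~w _     (here refl)         = ⊥-elim (Adj-irrefl e~w)
  close _ _   w≢nxt (there (here refl)) = ⊥-elim (w≢nxt refl)
  close {A = A} {w} (path e nxt rest uniq ins lnk) e~w _ (there (there w∈rest))
    with ys , zs , refl ← ∈-∃++ w∈rest = record
      { start    = e
      ; rest     = nxt ∷ ys ∷ʳ w
      ; long     = s≤s (subst (1 ≤_) (sym (length-++ ys)) (m≤n+m 1 (length ys)))
      ; distinct = AllPairs-++⁻ˡ (e ∷ nxt ∷ ys ∷ʳ w) (prefix {Unique} uniq)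
      ; inside   = All-++⁻ˡ (e ∷ nxt ∷ ys ∷ʳ w) (prefix {All (_∈ A)} ins)
      ; closed   = Linked-∷ʳ⁺ (e ∷ nxt ∷ ys)
                     (Linked-++⁻ˡ (e ∷ nxt ∷ ys ∷ʳ w) (prefix {Linked (Adj G)} lnk)) (Adj-sym e~w)
      }
    where
    prefix : ∀ {P : List (Fin n) → Set} → P (e ∷ nxt ∷ ys ++ w ∷ zs) → P ((e ∷ nxt ∷ ys ∷ʳ w) ++ zs)
    prefix {P} = subst P (sym (∷ʳ-++ (e ∷ nxt ∷ ys) w zs))

  extend : ∀ {w} (P : Path A) → w ∈ A → Adj G (end P) w → w ∉ fromList (vertices P) → Path A
  extend {w = w} P w∈A e~w w∉ = record
    { end    = w
    ; next   = end P
    ; rest   = next P ∷ rest P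
    ; distinct = ¬Any⇒All¬ (vertices P) (w∉ ∘ ∈ₗ⇒∈fromList) ∷ distinct P
    ; within = w∈A ∷ within P
    ; linked = Adj-sym e~w ∷ linked P
    }

  MinDegree2 : Subset n → Set
  MinDegree2 A = ∀ {u} → u ∈ A → 2 ≤ deg G A u

  grow : (P : Path A) → Acc _⊃_ (fromList (vertices P)) → MinDegree2 A → Cycle G A
  grow P (acc rs) deg≥2
    with w , w∈A , e~w , w≢nxt ← neighbour-avoiding (next P) (deg≥2 (All.head (within P)))
       | w ∈? fromList (vertices P)
  ... | yes w∈ = close P e~w w≢nxt (∈fromList⇒∈ₗ (vertices P) w∈)
  ... | no  w∉ = grow (extend P w∈A e~w w∉) (rs (q⊆p∪q ⁅ w ⁆ _ , w , x∈p∪q⁺ (inj₁ (x∈⁅x⁆ w)) , w∉)) deg≥2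

  minDegree2⇒Cycle : MinDegree2 A → u ∈ A → Cycle G A
  minDegree2⇒Cycle {u = u} deg≥2 u∈A
    with w , w∈A , u~w , w≢u ← neighbour-avoiding u (deg≥2 u∈A)
    = grow (path w u [] ((w≢u ∷ []) ∷ [] ∷ []) (w∈A ∷ u∈A ∷ []) (Adj-sym u~w ∷ [-])) (⊃-wellFounded _) deg≥2

  acyclic⇒degSum≤ : ∀ A → Acc _⊂_ A → ¬ Cycle G A → degSum A ≤ 2 * ∣ A ∣
  acyclic⇒degSum≤ A (acc rs) acyclic with any? (λ u → u ∈? A ×-dec deg G A u ≤? 1)
  ... | yes (u , u∈A , deg≤1) = begin
    degSum A                                   ≡⟨ degSum-remove u∈A ⟩
    deg G A u + (deg G A u + degSum (A - u))   ≤⟨ +-mono-≤ deg≤1 (+-mono-≤ deg≤1 IH) ⟩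
    2 + 2 * ∣ A - u ∣                          ≡⟨ *-suc 2 ∣ A - u ∣ ⟨
    2 * suc ∣ A - u ∣                          ≡⟨ cong (2 *_) (x∈p⇒∣p∣≡1+∣p-x∣ u∈A) ⟨
    2 * ∣ A ∣                                  ∎
    where
    open ≤-Reasoning
    IH = acyclic⇒degSum≤ (A - u) (rs (x∈p⇒p-x⊂p u∈A)) (acyclic ∘ Cycle-mono (p─q⊆p A ⁅ u ⁆))
  ... | no ∄leaf with nonempty? A
  ...   | yes (u , u∈A) = ⊥-elim (acyclic (minDegree2⇒Cycle deg≥2 u∈A))
    where
    deg≥2 : MinDegree2 A
    deg≥2 v∈A = ≰⇒> λ deg≤1 → ∄leaf (_ , v∈A , deg≤1)
  ...   | no  empty = ≤-trans (≤-reflexive (∑∈-empty _ empty)) z≤n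

  Loop-⊆ : ∀ {F X} → Loop G F A X → X ⊆ A
  Loop-⊆ (done _)               u∈⊥ = ⊥-elim (∉⊥ u∈⊥)
  Loop-⊆ (del c x∈c _ loop) = ∪⁅v⁆-⊆ (All.lookup (Cycle.inside c) x∈c) (Loop-⊆ loop)

  Loop⇒degSum≤ : ∀ {F X} → Loop G F A X → (∀ {u} → u ∈ A → u ∉ F → deg G A u ≤ 2) →
                 degSum A ≤ 2 * ∣ A ∣ + 2 * ∣ X ∣
  Loop⇒degSum≤ {A = A} (done acyclic) _ =
    ≤-trans (acyclic⇒degSum≤ A (⊂-wellFounded A) acyclic) (m≤m+n _ _)
  Loop⇒degSum≤ {A = A} (del {X = X} {x} c x∈c x∉F loop) deg≤2 = begin
    degSum A
      ≡⟨ degSum-remove x∈A ⟩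
    deg G A x + (deg G A x + degSum (A - x))
      ≤⟨ +-mono-≤ (deg≤2 x∈A x∉F) (+-mono-≤ (deg≤2 x∈A x∉F) IH) ⟩
    2 + (2 + (2 * ∣ A - x ∣ + 2 * ∣ X ∣))
      ≡⟨ regroup ∣ A - x ∣ ∣ X ∣ ⟩
    2 * suc ∣ A - x ∣ + 2 * suc ∣ X ∣
      ≡⟨ cong₂ (λ a b → 2 * a + 2 * b) (x∈p⇒∣p∣≡1+∣p-x∣ x∈A) (x∉p⇒∣p∪⁅x⁆∣≡1+∣p∣ x∉X) ⟨
    2 * ∣ A ∣ + 2 * ∣ X ∪ ⁅ x ⁆ ∣
      ∎
    where
    open ≤-Reasoning
    x∈A = All.lookup (Cycle.inside c) x∈c
    x∉X = x∉p-x ∘ Loop-⊆ loop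
    IH = Loop⇒degSum≤ loop λ u∈ u∉F → ≤-trans (deg-mono (p─q⊆p A ⁅ x ⁆)) (deg≤2 (p─q⊆p A ⁅ x ⁆ u∈) u∉F)
    regroup : ∀ a b → 2 + (2 + (2 * a + 2 * b)) ≡ 2 * suc a + 2 * suc b
    regroup = solve-∀

  -- The potential

  weight : Subset n → Subset n → Fin n → ℕ
  weight A F u = if does (u ∈? F) then deg G A u else 2 ⊓ deg G A u

  Φ : Subset n → Subset n → ℕ
  Φ A F = ∑∈ A (weight A F)

  weight≤deg : ∀ A F u → weight A F u ≤ deg G A u
  weight≤deg A F u with u ∈? F
  ... | yes _ = ≤-refl
  ... | no  _ = m⊓n≤n 2 _

  2≤weight : ∀ A F u → 2 ≤ deg G A u → 2 ≤ weight A F u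
  2≤weight A F u 2≤deg with u ∈? F
  ... | yes _ = 2≤deg
  ... | no  _ = ≤-reflexive (sym (m≤n⇒m⊓n≡m 2≤deg))

  weight-∉ : ∀ {F} → u ∉ F → weight A F u ≤ 2
  weight-∉ {u = u} {F = F} u∉F rewrite dec-false (u ∈? F) u∉F = m⊓n≤m 2 _

  weight-congʳ : ∀ {F F′} → (u ∈ F ⇔ u ∈ F′) → weight A F u ≡ weight A F′ u
  weight-congʳ {u = u} {F = F} {F′} F⇔F′ =
    cong (λ b → if b then _ else _) (does-⇔ F⇔F′ (u ∈? F) (u ∈? F′))

  -- Both branches of the weight are 1-Lipschitz in the degree.
  weight-remove : ∀ F → x ∈ A → ∀ u → weight A F u ≤ 𝟙 (nbr G u) x + weight (A - x) F u
  weight-remove {x = x} {A = A} F x∈A u rewrite deg-remove x∈A u with u ∈? F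
  ... | yes _ = ≤-refl
  ... | no  _ = begin
    2 ⊓ (k + d)           ≤⟨ ⊓-monoˡ-≤ (k + d) (m≤n+m 2 k) ⟩
    (k + 2) ⊓ (k + d)     ≡⟨ +-distribˡ-⊓ k 2 d ⟨
    k + 2 ⊓ d             ∎
    where
    open ≤-Reasoning
    k = 𝟙 (nbr G u) x
    d = deg G (A - x) u

  Φ-congʳ : ∀ {F F′} → (∀ {u} → u ∈ A → (u ∈ F ⇔ u ∈ F′)) → Φ A F ≡ Φ A F′
  Φ-congʳ {A = A} F⇔F′ = ∑∈-cong λ u∈A → weight-congʳ {A = A} (F⇔F′ u∈A)

  Φ-remove : ∀ F → x ∈ A → Φ A F ≤ weight A F x + (deg G A x + Φ (A - x) F)
  Φ-remove {x = x} {A = A} F x∈A = begin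
    Φ A F
      ≡⟨ ∑∈-remove _ x∈A ⟩
    w + ∑∈ (A - x) (weight A F)
      ≤⟨ +-monoʳ-≤ w (∑∈-mono-≤ {A = A - x} λ {u} _ → weight-remove F x∈A u) ⟩
    w + ∑∈ (A - x) (λ u → 𝟙 (nbr G u) x + weight (A - x) F u)
      ≡⟨ cong (w +_) (∑∈-distrib-+ (A - x) _ _) ⟩
    w + (∑∈ (A - x) (λ u → 𝟙 (nbr G u) x) + Φ (A - x) F)
      ≡⟨ cong (λ s → w + (s + Φ (A - x) F)) (∑∈-𝟙nbr x∈A) ⟩
    w + (deg G A x + Φ (A - x) F)
      ∎
    where
    open ≤-Reasoning
    w = weight A F x

  Φ-insert : ∀ {F} → x ∈ A → x ∉ F → 2 ≤ deg G A x → Φ A (F ∪ ⁅ x ⁆) ≡ Φ A F + (deg G A x ∸ 2)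
  Φ-insert {x = x} {A = A} {F} x∈A x∉F 2≤d = begin
    Φ A (F ∪ ⁅ x ⁆)                ≡⟨ ∑∈-remove _ x∈A ⟩
    weight A (F ∪ ⁅ x ⁆) x + R′    ≡⟨ cong (_+ R′) weight≡d ⟩
    d + R′                         ≡⟨ cong (d +_) (∑∈-cong {A = A - x} λ u∈ → weight-congʳ {A = A} (F∪⁅x⁆⇔F u∈)) ⟩
    d + R                          ≡⟨ cong (_+ R) (m+[n∸m]≡n 2≤d) ⟨
    2 + (d ∸ 2) + R                ≡⟨ xy∙z≈xz∙y 2 (d ∸ 2) R ⟩
    2 + R + (d ∸ 2)                ≡⟨ cong (λ w → w + R + (d ∸ 2)) weight≡2 ⟨
    weight A F x + R + (d ∸ 2)     ≡⟨ cong (_+ (d ∸ 2)) (∑∈-remove _ x∈A) ⟨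
    Φ A F + (d ∸ 2)                ∎
    where
    open ≡-Reasoning
    d  = deg G A x
    R  = ∑∈ (A - x) (weight A F)
    R′ = ∑∈ (A - x) (weight A (F ∪ ⁅ x ⁆))
    weight≡d : weight A (F ∪ ⁅ x ⁆) x ≡ d
    weight≡d rewrite dec-true (x ∈? F ∪ ⁅ x ⁆) (x∈p∪q⁺ (inj₂ (x∈⁅x⁆ x))) = refl
    weight≡2 : weight A F x ≡ 2
    weight≡2 rewrite dec-false (x ∈? F) x∉F = m≤n⇒m⊓n≡m 2≤d
    F∪⁅x⁆⇔F : ∀ {u} → u ∈ A - x → (u ∈ F ∪ ⁅ x ⁆ ⇔ u ∈ F)
    F∪⁅x⁆⇔F u∈ = mk⇔
      (λ u∈F∪⁅x⁆ → p∪⁅x⁆-x⊆p (x∈p∧x≢y⇒x∈p-y u∈F∪⁅x⁆ (x∈p-y⇒x≢y u∈)))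
      (p⊆p∪q ⁅ x ⁆)

  2∣A∣≤Φ : ∀ F → MinDegree2 A → 2 * ∣ A ∣ ≤ Φ A F
  2∣A∣≤Φ {A = A} F deg≥2 = begin
    2 * ∣ A ∣          ≡⟨ ∑∈-const A 2 ⟨
    ∑∈ A (λ _ → 2)    ≤⟨ ∑∈-mono-≤ (λ {u} u∈A → 2≤weight A F u (deg≥2 u∈A)) ⟩
    Φ A F             ∎
    where open ≤-Reasoning

  Φ≤degSum : ∀ A F → Φ A F ≤ degSum A
  Φ≤degSum A F = ∑∈-mono-≤ {A = A} λ {u} _ → weight≤deg A F u

  ExecPath-Vm⊆ : ∀ {k F Vm Fp} → ExecPath G k A F Vm Fp → Vm ⊆ A
  ExecPath-Vm⊆ (leaf-empty _ _)            u∈ = ⊥-elim (∉⊥ u∈)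
  ExecPath-Vm⊆ (step1 _ _ _ p)             u∈ = p─q⊆p _ _ (ExecPath-Vm⊆ p u∈)
  ExecPath-Vm⊆ (step2 _ _ v∈A _ _ p)       u∈ = ∪⁅v⁆-⊆ v∈A (ExecPath-Vm⊆ p) u∈
  ExecPath-Vm⊆ (leaf-step4 _ _ loop _)     u∈ = Loop-⊆ loop u∈
  ExecPath-Vm⊆ (step5 pick _ p)            u∈ = ∪⁅v⁆-⊆ (PicksAtStep3.v∈A pick) (ExecPath-Vm⊆ p) u∈
  ExecPath-Vm⊆ (step6 _ _ p)               u∈ = ExecPath-Vm⊆ p u∈

  ExcessBound : ℕ → Subset n → Subset n → Set
  ExcessBound E A F = ∀ {u} → u ∈ A → u ∉ F → deg G A u ≤ E + 2

  ExcessBound-remove : ∀ {E F} v → ExcessBound E A F → ExcessBound E (A - v) F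
  ExcessBound-remove {A = A} v bound u∈ u∉F =
    ≤-trans (deg-mono (p─q⊆p A ⁅ v ⁆)) (bound (p─q⊆p A ⁅ v ⁆ u∈) u∉F)

  ExcessBound-remove-both : ∀ {E F} v → ExcessBound E A F → ExcessBound E (A - v) (F - v)
  ExcessBound-remove-both v bound u∈ u∉F-v =
    ExcessBound-remove v bound u∈ (u∉F-v ∘ λ u∈F → x∈p∧x≢y⇒x∈p-y u∈F (x∈p-y⇒x≢y u∈))

  -- Induction along an execution path

  record PotentialBound (E : ℕ) (A F Vm Fp : Subset n) : Set where
    constructor bounded
    field
      bound : E * ∣ Fp ∣ + Φ A F ≤ E * (3 * ∣ Vm ∣) + 2 * ∣ A ∣

  PotentialBound-step1 : ∀ {E} {F Vm Fp : Subset n} → v ∈ A → deg G A v < 2 →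
    PotentialBound E (A - v) (F - v) Vm Fp → PotentialBound E A F Vm Fp
  PotentialBound-step1 {v = v} {A = A} {E} {F} {Vm} {Fp} v∈A d<2 (bounded IH) = bounded $ begin
    E * ∣ Fp ∣ + Φ A F
      ≤⟨ +-monoʳ-≤ _ (Φ-remove {A = A} F v∈A) ⟩
    E * ∣ Fp ∣ + (weight A F v + (deg G A v + Φ (A - v) F))
      ≤⟨ +-monoʳ-≤ _ (+-mono-≤ w≤1 (+-monoˡ-≤ _ d≤1)) ⟩
    E * ∣ Fp ∣ + (2 + Φ (A - v) F)
      ≡⟨ cong (λ φ → E * ∣ Fp ∣ + (2 + φ)) (Φ-congʳ F⇔F-v) ⟩
    E * ∣ Fp ∣ + (2 + Φ (A - v) (F - v))
      ≡⟨ x∙yz≈y∙xz (E * ∣ Fp ∣) 2 _ ⟩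
    2 + (E * ∣ Fp ∣ + Φ (A - v) (F - v))
      ≤⟨ +-monoʳ-≤ 2 IH ⟩
    2 + (S + 2 * ∣ A - v ∣)
      ≡⟨ x∙yz≈y∙xz 2 S _ ⟩
    S + (2 + 2 * ∣ A - v ∣)
      ≡⟨ cong (S +_) (*-suc 2 ∣ A - v ∣) ⟨
    S + 2 * suc ∣ A - v ∣
      ≡⟨ cong (λ a → S + 2 * a) (x∈p⇒∣p∣≡1+∣p-x∣ v∈A) ⟨
    S + 2 * ∣ A ∣
      ∎
    where
    open ≤-Reasoning
    S = E * (3 * ∣ Vm ∣)
    d≤1 = s≤s⁻¹ d<2
    w≤1 = ≤-trans (weight≤deg A F v) d≤1
    F⇔F-v : ∀ {u} → u ∈ A - v → (u ∈ F ⇔ u ∈ F - v)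
    F⇔F-v u∈ = mk⇔ (λ u∈F → x∈p∧x≢y⇒x∈p-y u∈F (x∈p-y⇒x≢y u∈)) (p─q⊆p F ⁅ v ⁆)

  PotentialBound-delete : ∀ {E} {F Vm Fp : Subset n} →
    0 < E → v ∈ A → v ∉ F → v ∉ Vm → deg G A v ≤ E + 2 →
    PotentialBound E (A - v) F Vm Fp → PotentialBound E A F (Vm ∪ ⁅ v ⁆) Fp
  PotentialBound-delete {v = v} {A = A} {E} {F} {Vm} {Fp} 0<E v∈A v∉F v∉Vm d≤E+2 (bounded IH) =
    bounded $ begin
    E * ∣ Fp ∣ + Φ A F
      ≤⟨ +-monoʳ-≤ _ (Φ-remove {A = A} F v∈A) ⟩
    E * ∣ Fp ∣ + (weight A F v + (deg G A v + Φ (A - v) F))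
      ≤⟨ +-monoʳ-≤ _ (+-mono-≤ (weight-∉ {A = A} v∉F) (+-monoˡ-≤ _ d≤E+2)) ⟩
    E * ∣ Fp ∣ + (2 + (E + 2 + Φ (A - v) F))
      ≡⟨ regroup (E * ∣ Fp ∣) E _ ⟩
    (E + 4) + (E * ∣ Fp ∣ + Φ (A - v) F)
      ≤⟨ +-mono-≤ (E+4≤3E+2 0<E) IH ⟩
    (3 * E + 2) + (E * (3 * ∣ Vm ∣) + 2 * ∣ A - v ∣)
      ≡⟨ expand E ∣ Vm ∣ ∣ A - v ∣ ⟩
    E * (3 * suc ∣ Vm ∣) + 2 * suc ∣ A - v ∣
      ≡⟨ cong₂ (λ a b → E * (3 * a) + 2 * b) (x∉p⇒∣p∪⁅x⁆∣≡1+∣p∣ v∉Vm) (x∈p⇒∣p∣≡1+∣p-x∣ v∈A) ⟨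
    E * (3 * ∣ Vm ∪ ⁅ v ⁆ ∣) + 2 * ∣ A ∣
      ∎
    where
    open ≤-Reasoning
    regroup : ∀ a e φ → a + (2 + (e + 2 + φ)) ≡ (e + 4) + (a + φ)
    regroup = solve-∀
    expand : ∀ e m c → (3 * e + 2) + (e * (3 * m) + 2 * c) ≡ e * (3 * suc m) + 2 * suc c
    expand = solve-∀
    E+4≤3E+2 : ∀ {e} → 0 < e → e + 4 ≤ 3 * e + 2
    E+4≤3E+2 {suc e} _ = ≤-trans (m≤m+n (suc e + 4) (e + e)) (≤-reflexive (split e))
      where
      split : ∀ e → suc e + 4 + (e + e) ≡ 3 * suc e + 2
      split = solve-∀

  PotentialBound-step4 : ∀ {E} {F X : Subset n} → 0 < E → Loop G F A X →
    (∀ {u} → u ∈ A → u ∉ F → deg G A u ≤ 2) → PotentialBound E A F X ⊥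
  PotentialBound-step4 {A = A} {E} {F} {X} 0<E loop deg≤2 = bounded $ begin
    E * ∣ ⊥ {n} ∣ + Φ A F           ≡⟨ cong (λ m → E * m + Φ A F) (∣⊥∣≡0 n) ⟩
    E * 0 + Φ A F                   ≡⟨ cong (_+ Φ A F) (*-zeroʳ E) ⟩
    Φ A F                           ≤⟨ Φ≤degSum A F ⟩
    degSum A                        ≤⟨ Loop⇒degSum≤ loop deg≤2 ⟩
    2 * ∣ A ∣ + 2 * ∣ X ∣            ≤⟨ +-monoʳ-≤ (2 * ∣ A ∣) (*-monoˡ-≤ ∣ X ∣ (n≤1+n 2)) ⟩
    2 * ∣ A ∣ + 3 * ∣ X ∣            ≤⟨ +-monoʳ-≤ (2 * ∣ A ∣) (m≤n*m (3 * ∣ X ∣) E {{>-nonZero 0<E}}) ⟩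
    2 * ∣ A ∣ + E * (3 * ∣ X ∣)      ≡⟨ +-comm (2 * ∣ A ∣) (E * (3 * ∣ X ∣)) ⟩
    E * (3 * ∣ X ∣) + 2 * ∣ A ∣      ∎
    where open ≤-Reasoning

  PotentialBound-step6 : ∀ {E} {F Vm Fp : Subset n} → MinDegree2 A → v ∈ A → v ∉ F →
    let e = deg G A v ∸ 2 in
    0 < e → e ≤ E →
    PotentialBound e A (F ∪ ⁅ v ⁆) Vm Fp → PotentialBound E A F Vm (Fp ∪ ⁅ v ⁆)
  PotentialBound-step6 {A = A} {v = v} {E} {F} {Vm} {Fp} deg≥2 v∈A v∉F 0<e e≤E (bounded IH)
    -- g = Φ A F − 2|A| is the part of the potential that survives rescaling from e to E.
    with g , c+g≡Φ ← m≤n⇒∃[o]m+o≡n (2∣A∣≤Φ F deg≥2) = bounded $ begin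
    E * ∣ Fp ∪ ⁅ v ⁆ ∣ + Φ A F       ≡⟨ cong (E * ∣ Fp ∪ ⁅ v ⁆ ∣ +_) c+g≡Φ ⟨
    E * ∣ Fp ∪ ⁅ v ⁆ ∣ + (c + g)     ≤⟨ +-monoˡ-≤ _ (*-monoʳ-≤ E (∣p∪⁅x⁆∣≤1+∣p∣ Fp v)) ⟩
    E * suc ∣ Fp ∣ + (c + g)         ≡⟨ x∙yz≈xz∙y (E * suc ∣ Fp ∣) c g ⟩
    (E * suc ∣ Fp ∣ + g) + c         ≤⟨ +-monoˡ-≤ c (scale-≤ 0<e e≤E small) ⟩
    E * (3 * ∣ Vm ∣) + c             ∎
    where
    open ≤-Reasoning
    e = deg G A v ∸ 2
    c = 2 * ∣ A ∣
    small : e * suc ∣ Fp ∣ + g ≤ e * (3 * ∣ Vm ∣)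
    small = +-cancelʳ-≤ c _ _ (begin
      e * suc ∣ Fp ∣ + g + c           ≡⟨ shuffle e ∣ Fp ∣ g c ⟩
      e * ∣ Fp ∣ + (c + g + e)         ≡⟨ cong (λ φ → e * ∣ Fp ∣ + (φ + e)) c+g≡Φ ⟩
      e * ∣ Fp ∣ + (Φ A F + e)         ≡⟨ cong (e * ∣ Fp ∣ +_) (Φ-insert v∈A v∉F (deg≥2 v∈A)) ⟨
      e * ∣ Fp ∣ + Φ A (F ∪ ⁅ v ⁆)    ≤⟨ IH ⟩
      e * (3 * ∣ Vm ∣) + c             ∎)
      where
      shuffle : ∀ e p g c → e * suc p + g + c ≡ e * p + (c + g + e)
      shuffle = solve-∀

  ExecPath⇒PotentialBound : ∀ {k E} {F Vm Fp : Subset n} →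
    ExecPath G k A F Vm Fp → 0 < E → ExcessBound E A F → PotentialBound E A F Vm Fp
  ExecPath⇒PotentialBound {A = A} {E = E} {F} (leaf-empty _ empty) _ _ = bounded $ ≤-trans (≤-reflexive (begin
    E * ∣ ⊥ {n} ∣ + Φ A F   ≡⟨ cong₂ (λ m φ → E * m + φ) (∣⊥∣≡0 n) (∑∈-empty _ empty) ⟩
    E * 0 + 0               ≡⟨ cong (_+ 0) (*-zeroʳ E) ⟩
    0                       ∎)) z≤n
    where open ≡-Reasoning
  ExecPath⇒PotentialBound (step1 _ v∈A d<2 p) 0<E bound =
    PotentialBound-step1 v∈A d<2 (ExecPath⇒PotentialBound p 0<E (ExcessBound-remove-both _ bound))
  ExecPath⇒PotentialBound (step2 _ _ v∈A v∉F _ p) 0<E bound =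
    PotentialBound-delete 0<E v∈A v∉F (x∉p-x ∘ ExecPath-Vm⊆ p) (bound v∈A v∉F)
      (ExecPath⇒PotentialBound p 0<E (ExcessBound-remove _ bound))
  ExecPath⇒PotentialBound (leaf-step4 pick d≡2 loop _) 0<E _ =
    PotentialBound-step4 0<E loop λ u∈A u∉F → subst (_ ≤_) d≡2 (maxdeg _ u∈A u∉F)
    where open PicksAtStep3 pick
  ExecPath⇒PotentialBound (step5 pick _ p) 0<E bound =
    PotentialBound-delete 0<E v∈A v∉F (x∉p-x ∘ ExecPath-Vm⊆ p) (bound v∈A v∉F)
      (ExecPath⇒PotentialBound p 0<E (ExcessBound-remove _ bound))
    where open PicksAtStep3 pick
  ExecPath⇒PotentialBound {A = A} {E = E} {F} (step6 {v = v} pick d≢2 p) 0<E bound =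
    PotentialBound-step6 deg≥2 v∈A v∉F 0<e e≤E (ExecPath⇒PotentialBound p 0<e bound′)
    where
    open PicksAtStep3 pick
    deg≥2 : MinDegree2 A
    deg≥2 = no-step1 _
    2<d : 2 < deg G A v
    2<d = ≤∧≢⇒< (deg≥2 v∈A) (d≢2 ∘ sym)
    0<e : 0 < deg G A v ∸ 2
    0<e = ∸-monoˡ-≤ 2 2<d
    e≤E : deg G A v ∸ 2 ≤ E
    e≤E = ≤-trans (∸-monoˡ-≤ 2 (bound v∈A v∉F)) (≤-reflexive (m+n∸n≡m E 2))
    bound′ : ExcessBound (deg G A v ∸ 2) A (F ∪ ⁅ v ⁆)
    bound′ u∈A u∉F∪⁅v⁆ =
      ≤-trans (maxdeg _ u∈A (u∉F∪⁅v⁆ ∘ p⊆p∪q ⁅ v ⁆)) (≤-reflexive (sym (m∸n+n≡m (deg≥2 v∈A))))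

lemma3 : (n : ℕ) (G : SimpleGraph n) (k : ℤ) (Vm Fp : Subset n) →
    ExecPath G k ⊤ ⊥ Vm Fp → ∣ Fp ∣ ≤ 3 * ∣ Vm ∣
lemma3 n G k Vm Fp run = s≤s⁻¹ (*-cancelˡ-< E ∣ Fp ∣ (suc (3 * ∣ Vm ∣)) (begin-strict
  E * ∣ Fp ∣                         ≤⟨ m≤m+n (E * ∣ Fp ∣) (Φ G ⊤ ⊥) ⟩
  E * ∣ Fp ∣ + Φ G ⊤ ⊥               ≤⟨ PotentialBound.bound (ExecPath⇒PotentialBound G run z<s degree-bound) ⟩
  E * (3 * ∣ Vm ∣) + 2 * ∣ ⊤ {n} ∣    <⟨ +-monoʳ-< (E * (3 * ∣ Vm ∣)) (s≤s (*-monoʳ-≤ 2 (∣p∣≤n (⊤ {n})))) ⟩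
  E * (3 * ∣ Vm ∣) + E               ≡⟨ +-comm (E * (3 * ∣ Vm ∣)) E ⟩
  E + E * (3 * ∣ Vm ∣)               ≡⟨ *-suc E (3 * ∣ Vm ∣) ⟨
  E * suc (3 * ∣ Vm ∣)               ∎))
  where
  open ≤-Reasoning
  E = suc (2 * n)
  degree-bound : ExcessBound G E ⊤ ⊥
  degree-bound {u} _ _ = ≤-trans (∣p∣≤n (⊤ ∩ nbr G u)) (≤-trans (m≤m+n n (n + 0)) (≤-trans (n≤1+n (2 * n)) (m≤m+n E 2)))
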